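{- If a graph family $\mathcal{F}$ contains a bipartite graph, a co-bipartite graph and a split graph, then $\mathcal{F}$ has a bipartite obstruction.
   Context: A graph is co-bipartite if its vertex set can be partitioned into two cliques, and split if its vertex set can be partitioned into a clique and an independent set. Let $H=(S\cup T,E)$ be a bipartite graph with sides $S,T$. A completion of $H$ is any graph on $V(H)$ whose edges between $S$ and $T$ are exactly those of $H$ (with arbitrary edges inside $S$ and inside $T$). $H$ is a bipartite obstruction for $\mathcal{F}$ if every completion of $H$ contains an induced copy of some graph of $\mathcal{F}$. -}

module Defs where

open import Data.Nat using (ℕ)
open import Data.Fin using (Fin)
open import Data.Bool using (Bool; true; false)
open import Data.Product using (Σ; _×_; ∃)
open import Relation.Binary.PropositionalEquality using (_≡_; _≢_)
open import Function.Definitions using (Injective)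

record Graph (n : ℕ) : Set where
  field
    adj    : Fin n → Fin n → Bool
    sym    : ∀ u v → adj u v ≡ adj v u
    irrefl : ∀ u → adj u u ≡ false
open Graph public

Family : Set₁
Family = (n : ℕ) → Graph n → Set

IsBipartite : ∀ {n} → Graph n → Set
IsBipartite {n} G = Σ (Fin n → Bool) λ side →
  ∀ u v → side u ≡ side v → adj G u v ≡ false

IsCoBipartite : ∀ {n} → Graph n → Set
IsCoBipartite {n} G = Σ (Fin n → Bool) λ side →
  ∀ u v → u ≢ v → side u ≡ side v → adj G u v ≡ true

IsSplit : ∀ {n} → Graph n → Set
IsSplit {n} G = Σ (Fin n → Bool) λ side →
  (∀ u v → u ≢ v → side u ≡ true → side v ≡ true → adj G u v ≡ true) ×
  (∀ u v → side u ≡ false → side v ≡ false → adj G u v ≡ false)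

InducedCopy : ∀ {m n} → Graph m → Graph n → Set
InducedCopy {m} {n} F G = Σ (Fin m → Fin n) λ f →
  Injective _≡_ _≡_ f × (∀ i j → adj G (f i) (f j) ≡ adj F i j)

-- A bipartite graph H = (S ∪ T, E) with its fixed sides (S = side true, T = side false).
record BipartiteGraph : Set where
  field
    size  : ℕ
    graph : Graph size
    side  : Fin size → Bool
    bip   : ∀ u v → side u ≡ side v → adj graph u v ≡ false
open BipartiteGraph public

IsCompletion : (H : BipartiteGraph) → Graph (size H) → Set
IsCompletion H G = ∀ u v → side H u ≢ side H v → adj G u v ≡ adj (graph H) u v

IsBipartiteObstruction : Family → BipartiteGraph → Set
IsBipartiteObstruction 𝓕 H = (G : Graph (size H)) → IsCompletion H G →
  Σ ℕ λ m → Σ (Graph m) λ F → 𝓕 m F × InducedCopy F G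

HasBipartiteObstruction : Family → Set
HasBipartiteObstruction 𝓕 = Σ BipartiteGraph λ H → IsBipartiteObstruction 𝓕 H

module Submission where

-- For each pair of colours (a , b)
-- 𝓕 contains a graph whose vertices split into a part that is a clique (a = true)
-- or independent (a = false) and a part that is a clique (b = true) or independent
-- (b = false): the bipartite, co-bipartite and split members give the four cases.
-- The obstruction H has S = Fin N and T = (rows of m S-vertices) × Fin M.  In a
-- completion G, Ramsey's theorem yields a row of m S-vertices that is homogeneous
-- in G (colour b₁), and then K T-vertices over that row that are homogeneous too
-- (colour b₂).  The S-vertices of the row carry labels, arranged so that the S–T
-- edges of H between the row and the chosen T-vertices realise the edges between
-- the two parts of the member of type (b₁ , b₂); that member then embeds into G.

open import Defs hiding (sym)
open import Data.Nat using (ℕ; zero; suc; _+_; _*_; _^_; _≤_; _⊔_)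
open import Data.Nat.Properties
  using (+-suc; +-cancelˡ-≤; +-monoˡ-≤; +-identityʳ; ≤-trans; ≤-reflexive; ≰⇒>; <⇒≱;
         m^n>0; _≤?_; m≤m⊔n; m≤n⊔m)
open import Data.Fin using (Fin; zero; suc; inject≤; _≟_)
open import Data.Fin.Properties using (1↔⊤; 2↔Bool; +↔⊎; *↔×; any?; inject≤-injective)
open import Data.Bool using (Bool; true; false; not)
open import Data.Bool.Properties using (not-injective) renaming (_≟_ to _≟ᵇ_)
open import Data.Product using (Σ; ∃; _×_; _,_; proj₁; proj₂)
open import Data.Product.Function.NonDependent.Propositional using (_×-↔_)
open import Data.Sum using (_⊎_; inj₁; inj₂; [_,_]′)
open import Data.Sum.Properties using (inj₁-injective; inj₂-injective)
open import Data.Sum.Function.Propositional using (_⊎-↔_)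
open import Data.Empty using (⊥-elim)
open import Data.Unit using (⊤; tt)
open import Data.Vec using (Vec; []; _∷_; lookup; tabulate)
open import Data.Vec.Properties using (lookup∘tabulate)
open import Data.List using (List; []; _∷_; length; filter; allFin)
open import Data.List.Properties using (length-tabulate)
open import Data.List.Membership.Propositional using (_∈_; _∉_)
open import Data.List.Membership.Propositional.Properties using (∈-filter⁻)
open import Data.List.Relation.Unary.Any using (here; there)
open import Data.List.Relation.Unary.All.Properties using (All¬⇒¬Any)
open import Data.List.Relation.Unary.AllPairs using (_∷_)
open import Data.List.Relation.Unary.Unique.Propositional using (Unique)
open import Data.List.Relation.Unary.Unique.Propositional.Properties using (filter⁺; allFin⁺)
open import Function.Bundles using (_↔_; _⇔_; Inverse; Equivalence; mk↔ₛ′; mk⇔)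
open import Function.Definitions using (Injective)
open import Function.Properties.Inverse using (↔-refl; ↔-trans)
open import Relation.Binary.PropositionalEquality
open import Relation.Nullary using (Dec; yes; no; does; _×-dec_)
open import Relation.Nullary.Decidable using (dec-true; dec-false)

-- A type in bijection with Fin count; graphs on it can be moved to Fin count.
record Enumeration (X : Set) : Set where
  field
    count     : ℕ
    bijection : Fin count ↔ X

  decode : Fin count → X
  decode = Inverse.to bijection

  encode : X → Fin count
  encode = Inverse.from bijection

  decode-encode : ∀ x → decode (encode x) ≡ x
  decode-encode = Inverse.strictlyInverseˡ bijection

  encode-injective : Injective _≡_ _≡_ encode
  encode-injective {x} {y} e =
    trans (sym (decode-encode x)) (trans (cong decode e) (decode-encode y))

open Enumeration

finEnum : ∀ n → Enumeration (Fin n)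
finEnum n = record { count = n ; bijection = ↔-refl }

boolEnum : Enumeration Bool
boolEnum = record { count = 2 ; bijection = 2↔Bool }

_⊎-enum_ : ∀ {X Y} → Enumeration X → Enumeration Y → Enumeration (X ⊎ Y)
E ⊎-enum F = record
  { count = count E + count F ; bijection = ↔-trans +↔⊎ (bijection E ⊎-↔ bijection F) }

_×-enum_ : ∀ {X Y} → Enumeration X → Enumeration Y → Enumeration (X × Y)
E ×-enum F = record
  { count = count E * count F ; bijection = ↔-trans *↔× (bijection E ×-↔ bijection F) }

vecEnum : ∀ {X} → Enumeration X → ∀ n → Enumeration (Vec X n)
vecEnum {X} E zero = record { count = 1 ; bijection = ↔-trans 1↔⊤ nil↔ }
  where
  nil↔ : ⊤ ↔ Vec X 0
  nil↔ = mk↔ₛ′ (λ _ → []) (λ _ → tt) (λ { [] → refl }) (λ _ → refl)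
vecEnum {X} E (suc n) = record
  { count = count (E ×-enum vecEnum E n)
  ; bijection = ↔-trans (bijection (E ×-enum vecEnum E n)) cons↔ }
  where
  cons↔ : (X × Vec X n) ↔ Vec X (suc n)
  cons↔ = mk↔ₛ′ (λ (x , xs) → x ∷ xs) (λ { (x ∷ xs) → x , xs })
                (λ { (x ∷ xs) → refl }) (λ (x , xs) → refl)

half-of-bound : ∀ n a b → 2 ^ suc n ≤ suc (a + b) → 2 ^ n ≤ a ⊎ 2 ^ n ≤ b
half-of-bound n a b bound with 2 ^ n ≤? a
... | yes 2ⁿ≤a = inj₁ 2ⁿ≤a
... | no 2ⁿ≰a = inj₂ (+-cancelˡ-≤ (2 ^ n) (2 ^ n) b
                        (≤-trans doubled (+-monoˡ-≤ b (≰⇒> 2ⁿ≰a))))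
  where
  doubled : 2 ^ n + 2 ^ n ≤ suc a + b
  doubled = subst (_≤ suc (a + b)) (cong (2 ^ n +_) (+-identityʳ (2 ^ n))) bound

module Ramsey {X : Set} (c : X → X → Bool) (c-sym : ∀ x y → c x y ≡ c y x) where

  record HomogeneousIn (b : Bool) (k : ℕ) (xs : List X) : Set where
    field
      pick           : Fin k → X
      pick-∈         : ∀ i → pick i ∈ xs
      pick-injective : Injective _≡_ _≡_ pick
      pick-colour    : ∀ i j → i ≢ j → c (pick i) (pick j) ≡ b
  open HomogeneousIn

  empty : ∀ {b xs} → HomogeneousIn b 0 xs
  empty = record { pick = λ () ; pick-∈ = λ () ; pick-injective = λ { {()} } ; pick-colour = λ () }

  widen : ∀ {b k xs ys} → (∀ {y} → y ∈ xs → y ∈ ys) →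
          HomogeneousIn b k xs → HomogeneousIn b k ys
  widen xs⊆ys h = record
    { pick = pick h ; pick-∈ = λ i → xs⊆ys (pick-∈ h i)
    ; pick-injective = pick-injective h ; pick-colour = pick-colour h }

  class : X → Bool → List X → List X
  class x b = filter (λ y → c x y ≟ᵇ b)

  classes-cover : ∀ x xs → length (class x true xs) + length (class x false xs) ≡ length xs
  classes-cover x [] = refl
  classes-cover x (y ∷ ys) with c x y
  ... | true  = cong suc (classes-cover x ys)
  ... | false = trans (+-suc _ _) (cong suc (classes-cover x ys))

  class-⊆ : ∀ {x b xs y} → y ∈ class x b xs → y ∈ x ∷ xs
  class-⊆ y∈ = there (proj₁ (∈-filter⁻ _ y∈))

  extend : ∀ {b k} x xs → x ∉ xs → HomogeneousIn b k (class x b xs) →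
           HomogeneousIn b (suc k) (x ∷ xs)
  extend {b} x xs x∉xs h = record
    { pick = pick′ ; pick-∈ = pick′-∈
    ; pick-injective = pick′-injective ; pick-colour = pick′-colour }
    where
    in-class : ∀ i → pick h i ∈ xs × c x (pick h i) ≡ b
    in-class i = ∈-filter⁻ (λ y → c x y ≟ᵇ b) (pick-∈ h i)

    x≢pick : ∀ i → x ≢ pick h i
    x≢pick i x≡ = x∉xs (subst (_∈ xs) (sym x≡) (proj₁ (in-class i)))

    pick′ : Fin _ → X
    pick′ zero    = x
    pick′ (suc i) = pick h i

    pick′-∈ : ∀ i → pick′ i ∈ (x ∷ xs)
    pick′-∈ zero    = here refl
    pick′-∈ (suc i) = there (proj₁ (in-class i))

    pick′-injective : Injective _≡_ _≡_ pick′
    pick′-injective {zero}  {zero}  _ = refl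
    pick′-injective {zero}  {suc j} e = ⊥-elim (x≢pick j e)
    pick′-injective {suc i} {zero}  e = ⊥-elim (x≢pick i (sym e))
    pick′-injective {suc i} {suc j} e = cong suc (pick-injective h e)

    pick′-colour : ∀ i j → i ≢ j → c (pick′ i) (pick′ j) ≡ b
    pick′-colour zero    zero    i≢j = ⊥-elim (i≢j refl)
    pick′-colour zero    (suc j) _   = proj₂ (in-class j)
    pick′-colour (suc i) zero    _   = trans (c-sym _ x) (proj₂ (in-class i))
    pick′-colour (suc i) (suc j) i≢j = pick-colour h i j (λ e → i≢j (cong suc e))

  ramsey : ∀ p q xs → Unique xs → 2 ^ (p + q) ≤ length xs →
           HomogeneousIn true p xs ⊎ HomogeneousIn false q xs
  ramsey zero    q       xs       _ _     = inj₁ empty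
  ramsey (suc p) zero    xs       _ _     = inj₂ empty
  ramsey (suc p) (suc q) []       _ bound = ⊥-elim (<⇒≱ (m^n>0 2 (suc p + suc q)) bound)
  ramsey (suc p) (suc q) (x ∷ xs) (x≢xs ∷ unique) bound
    with half-of-bound (p + suc q) (length (class x true xs)) (length (class x false xs))
           (subst (λ l → 2 ^ suc (p + suc q) ≤ suc l) (sym (classes-cover x xs)) bound)
  ... | inj₁ big-true
    with ramsey p (suc q) (class x true xs) (filter⁺ _ unique) big-true
  ...   | inj₁ h = inj₁ (extend x xs (All¬⇒¬Any x≢xs) h)
  ...   | inj₂ h = inj₂ (widen class-⊆ h)
  ramsey (suc p) (suc q) (x ∷ xs) (x≢xs ∷ unique) bound
      | inj₂ big-false
    with ramsey (suc p) q (class x false xs) (filter⁺ _ unique)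
           (subst (λ e → 2 ^ e ≤ length (class x false xs)) (+-suc p q) big-false)
  ...   | inj₁ h = inj₁ (widen class-⊆ h)
  ...   | inj₂ h = inj₂ (extend x xs (All¬⇒¬Any x≢xs) h)

record Homogeneous {X : Set} (c : X → X → Bool) (k : ℕ) : Set where
  field
    colour         : Bool
    pick           : Fin k → X
    pick-injective : Injective _≡_ _≡_ pick
    pick-colour    : ∀ i j → i ≢ j → c (pick i) (pick j) ≡ colour

ramsey-Fin : ∀ k (c : Fin (2 ^ (k + k)) → Fin (2 ^ (k + k)) → Bool) →
             (∀ x y → c x y ≡ c y x) → Homogeneous c k
ramsey-Fin k c c-sym =
  [ forget , forget ]′
    (ramsey k k (allFin N) (allFin⁺ N) (≤-reflexive (sym (length-tabulate (λ i → i)))))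
  where
  N : ℕ
  N = 2 ^ (k + k)
  open Ramsey c c-sym
  forget : ∀ {b} → HomogeneousIn b k (allFin N) → Homogeneous c k
  forget {b} h = record { colour = b ; pick = pick h ; pick-injective = pick-injective h
                        ; pick-colour = pick-colour h }
    where open HomogeneousIn

does-⇔ : ∀ {P : Set} (P? : Dec P) {b : Bool} → P ⇔ (b ≡ true) → does P? ≡ b
does-⇔ P? {true}  P⇔b = dec-true P? (Equivalence.from P⇔b refl)
does-⇔ P? {false} P⇔b = dec-false P? (λ p → false≢true (Equivalence.to P⇔b p))
  where
  false≢true : false ≢ true
  false≢true ()

record SidedMember (𝓕 : Family) (a b : Bool) : Set where
  field
    order      : ℕ
    shape      : Graph order
    inFamily   : 𝓕 order shape
    part       : Fin order → Bool
    part-true  : ∀ u v → u ≢ v → part u ≡ true  → part v ≡ true  → adj shape u v ≡ a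
    part-false : ∀ u v → u ≢ v → part u ≡ false → part v ≡ false → adj shape u v ≡ b
open SidedMember

module _ {𝓕 : Family} where

  fromBipartite : Σ ℕ (λ n → Σ (Graph n) λ B → 𝓕 n B × IsBipartite B) →
                  SidedMember 𝓕 false false
  fromBipartite (n , B , B∈𝓕 , side , indep) = record
    { order = n ; shape = B ; inFamily = B∈𝓕 ; part = side
    ; part-true  = λ u v _ pu pv → indep u v (trans pu (sym pv))
    ; part-false = λ u v _ pu pv → indep u v (trans pu (sym pv)) }

  fromCoBipartite : Σ ℕ (λ n → Σ (Graph n) λ C → 𝓕 n C × IsCoBipartite C) →
                    SidedMember 𝓕 true true
  fromCoBipartite (n , C , C∈𝓕 , side , clique) = record
    { order = n ; shape = C ; inFamily = C∈𝓕 ; part = side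
    ; part-true  = λ u v u≢v pu pv → clique u v u≢v (trans pu (sym pv))
    ; part-false = λ u v u≢v pu pv → clique u v u≢v (trans pu (sym pv)) }

  fromSplit : Σ ℕ (λ n → Σ (Graph n) λ S → 𝓕 n S × IsSplit S) → SidedMember 𝓕 true false
  fromSplit (n , S , S∈𝓕 , side , clique , indep) = record
    { order = n ; shape = S ; inFamily = S∈𝓕 ; part = side
    ; part-true = clique ; part-false = λ u v _ → indep u v }

  swapParts : ∀ {a b} → SidedMember 𝓕 a b → SidedMember 𝓕 b a
  swapParts P = record
    { order = order P ; shape = shape P ; inFamily = inFamily P ; part = λ u → not (part P u)
    ; part-true  = λ u v u≢v pu pv → part-false P u v u≢v (not-injective pu) (not-injective pv)
    ; part-false = λ u v u≢v pu pv → part-true P u v u≢v (not-injective pu) (not-injective pv) }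

  sidedMembers : Σ ℕ (λ n → Σ (Graph n) λ B → 𝓕 n B × IsBipartite B) →
                 Σ ℕ (λ n → Σ (Graph n) λ C → 𝓕 n C × IsCoBipartite C) →
                 Σ ℕ (λ n → Σ (Graph n) λ S → 𝓕 n S × IsSplit S) →
                 ∀ a b → SidedMember 𝓕 a b
  sidedMembers bip cobip split false false = fromBipartite bip
  sidedMembers bip cobip split true  true  = fromCoBipartite cobip
  sidedMembers bip cobip split true  false = fromSplit split
  sidedMembers bip cobip split false true  = swapParts (fromSplit split)

maxOver : (Bool → Bool → ℕ) → ℕ
maxOver f = (f false false ⊔ f false true) ⊔ (f true false ⊔ f true true)

≤-maxOver : ∀ f a b → f a b ≤ maxOver f
≤-maxOver f false false = ≤-trans (m≤m⊔n (f false false) _) (m≤m⊔n _ (f true false ⊔ f true true))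
≤-maxOver f false true  = ≤-trans (m≤n⊔m (f false false) _) (m≤m⊔n _ (f true false ⊔ f true true))
≤-maxOver f true  false = ≤-trans (m≤m⊔n (f true false) _) (m≤n⊔m (f false false ⊔ f false true) _)
≤-maxOver f true  true  = ≤-trans (m≤n⊔m (f true false) _) (m≤n⊔m (f false false ⊔ f false true) _)

module Enumerated {X : Set} (E : Enumeration X) (rel : X → X → Bool)
                  (rel-sym : ∀ x y → rel x y ≡ rel y x) (half : X → Bool)
                  (rel-bip : ∀ x y → half x ≡ half y → rel x y ≡ false) where

  bipartiteGraph : BipartiteGraph
  bipartiteGraph = record
    { size  = count E
    ; graph = record { adj    = λ u v → rel (decode E u) (decode E v)
                     ; sym    = λ u v → rel-sym (decode E u) (decode E v)
                     ; irrefl = λ u → rel-bip (decode E u) (decode E u) refl }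
    ; side  = λ u → half (decode E u)
    ; bip   = λ u v → rel-bip (decode E u) (decode E v) }

  completion-across : ∀ {G : Graph (count E)} → IsCompletion bipartiteGraph G →
                      ∀ x y → half x ≢ half y → adj G (encode E x) (encode E y) ≡ rel x y
  completion-across {G} comp x y different = begin
    adj G (encode E x) (encode E y)                     ≡⟨ comp _ _ different′ ⟩
    rel (decode E (encode E x)) (decode E (encode E y)) ≡⟨ cong₂ rel (decode-encode E x)
                                                                     (decode-encode E y) ⟩
    rel x y                                             ∎
    where
    open ≡-Reasoning
    different′ : half (decode E (encode E x)) ≢ half (decode E (encode E y))
    different′ = subst₂ (λ x′ y′ → half x′ ≢ half y′)
                        (sym (decode-encode E x)) (sym (decode-encode E y)) different

module Construction {𝓕 : Family} (member : ∀ a b → SidedMember 𝓕 a b)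
                    (K : ℕ) (fits : ∀ a b → order (member a b) ≤ K) where

  slot : ∀ a b → Fin (order (member a b)) → Fin K
  slot a b u = inject≤ u (fits a b)

  slot-injective : ∀ a b → Injective _≡_ _≡_ (slot a b)
  slot-injective a b {u} {v} = inject≤-injective (fits a b) (fits a b) u v

  -- Among M T-vertices over a fixed row, Ramsey finds K homogeneous ones.
  M : ℕ
  M = 2 ^ (K + K)

  -- A label ((a , b) , g , u) stands for vertex u of member a b when that member's
  -- false part is placed at the T-positions g.
  Label : Set
  Label = (Bool × Bool) × Vec (Fin M) K × Fin K

  -- The T-positions a labelled S-vertex must be adjacent to: those holding a vertex w
  -- of the false part that is adjacent to the labelled vertex u.
  Requests : Label → Fin M → Set
  Requests ((a , b) , g , u) i =
    ∃ λ w → lookup g (slot a b w) ≡ i × part (member a b) w ≡ false ×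
            ∃ λ v → slot a b v ≡ u × adj (shape (member a b)) v w ≡ true

  requests? : ∀ ℓ i → Dec (Requests ℓ i)
  requests? ((a , b) , g , u) i =
    any? λ w → (lookup g (slot a b w) ≟ i) ×-dec (part (member a b) w ≟ᵇ false) ×-dec
               any? λ v → (slot a b v ≟ u) ×-dec (adj (shape (member a b)) v w ≟ᵇ true)

  labels : Enumeration Label
  labels = (boolEnum ×-enum boolEnum) ×-enum (vecEnum (finEnum M) K ×-enum finEnum K)

  m : ℕ
  m = count labels

  -- Among N S-vertices, Ramsey finds a homogeneous row of m, one for each label.
  N : ℕ
  N = 2 ^ (m + m)

  Row : Set
  Row = Vec (Fin N) m

  Vertex : Set
  Vertex = Fin N ⊎ (Row × Fin M)

  vertices : Enumeration Vertex
  vertices = finEnum N ⊎-enum (vecEnum (finEnum N) m ×-enum finEnum M)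

  Linked : Fin N → Row × Fin M → Set
  Linked s (row , i) = ∃ λ c → lookup row c ≡ s × Requests (decode labels c) i

  linked? : ∀ s t → Dec (Linked s t)
  linked? s (row , i) = any? λ c → (lookup row c ≟ s) ×-dec requests? (decode labels c) i

  inS : Vertex → Bool
  inS (inj₁ _) = true
  inS (inj₂ _) = false

  cross : Vertex → Vertex → Bool
  cross (inj₁ s) (inj₂ t) = does (linked? s t)
  cross (inj₂ t) (inj₁ s) = does (linked? s t)
  cross (inj₁ _) (inj₁ _) = false
  cross (inj₂ _) (inj₂ _) = false

  cross-sym : ∀ x y → cross x y ≡ cross y x
  cross-sym (inj₁ _) (inj₁ _) = refl
  cross-sym (inj₁ _) (inj₂ _) = refl
  cross-sym (inj₂ _) (inj₁ _) = refl
  cross-sym (inj₂ _) (inj₂ _) = refl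

  cross-bip : ∀ x y → inS x ≡ inS y → cross x y ≡ false
  cross-bip (inj₁ _) (inj₁ _) _ = refl
  cross-bip (inj₂ _) (inj₂ _) _ = refl

  open Enumerated vertices cross cross-sym inS cross-bip

  H : BipartiteGraph
  H = bipartiteGraph

  module Embedding (G : Graph (size H)) (completion : IsCompletion H G) where

    edge : Vertex → Vertex → Bool
    edge x y = adj G (encode vertices x) (encode vertices y)

    colourS : Fin N → Fin N → Bool
    colourS s s′ = edge (inj₁ s) (inj₁ s′)

    colourT : Row → Fin M → Fin M → Bool
    colourT row i i′ = edge (inj₂ (row , i)) (inj₂ (row , i′))

    module _ (rowS : Homogeneous colourS m)
             (posT : Homogeneous (colourT (tabulate (Homogeneous.pick rowS))) K) where

      open Homogeneous rowS using () renaming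
        (colour to b₁; pick to rowOf; pick-injective to rowOf-injective; pick-colour to rowOf-colour)
      open Homogeneous posT using () renaming
        (colour to b₂; pick to τ; pick-injective to τ-injective; pick-colour to τ-colour)

      row : Row
      row = tabulate rowOf

      P : SidedMember 𝓕 b₁ b₂
      P = member b₁ b₂

      σ : Fin (order P) → Bool
      σ = part P

      label : Fin (order P) → Label
      label u = (b₁ , b₂) , tabulate τ , slot b₁ b₂ u

      label-injective : Injective _≡_ _≡_ label
      label-injective e = slot-injective b₁ b₂ (cong (λ ℓ → proj₂ (proj₂ ℓ)) e)

      -- The S-vertex of u (used when u is in the true part) and its T-vertex (false part).
      place : Fin (order P) → Bool → Vertex
      place u true  = inj₁ (rowOf (encode labels (label u)))
      place u false = inj₂ (row , τ (slot b₁ b₂ u))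

      linked-iff : ∀ i j → σ j ≡ false →
                   Linked (rowOf (encode labels (label i))) (row , τ (slot b₁ b₂ j)) ⇔
                   (adj (shape P) i j ≡ true)
      linked-iff i j σj = mk⇔ forward backward
        where
        -- A linking position c must hold label i; its request for the position of j
        -- then comes from w = j, adjacent to v = i.
        forward : Linked (rowOf (encode labels (label i))) (row , τ (slot b₁ b₂ j)) →
                  adj (shape P) i j ≡ true
        forward (c , c-holds , req) with rowOf-injective (trans (sym (lookup∘tabulate rowOf c)) c-holds)
        ... | refl with subst (λ ℓ → Requests ℓ (τ (slot b₁ b₂ j))) (decode-encode labels (label i)) req
        ...   | w , w-at , _ , v , v-slot , vw
          with slot-injective b₁ b₂ (τ-injective (trans (sym (lookup∘tabulate τ _)) w-at))
             | slot-injective b₁ b₂ v-slot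
        ...   | refl | refl = vw
        backward : adj (shape P) i j ≡ true →
                   Linked (rowOf (encode labels (label i))) (row , τ (slot b₁ b₂ j))
        backward ij = encode labels (label i) , lookup∘tabulate rowOf _ ,
                      subst (λ ℓ → Requests ℓ (τ (slot b₁ b₂ j))) (sym (decode-encode labels (label i)))
                            (j , lookup∘tabulate τ _ , σj , i , refl , ij)

      edge-across : ∀ i j → σ j ≡ false → edge (place i true) (place j false) ≡ adj (shape P) i j
      edge-across i j σj =
        trans (completion-across {G} completion (place i true) (place j false) (λ ()))
              (does-⇔ (linked? (rowOf (encode labels (label i))) (row , τ (slot b₁ b₂ j)))
                      (linked-iff i j σj))

      -- Same-part pairs are governed by the homogeneity of the row and of τ,
      -- cross pairs by linked-iff.
      edge-place : ∀ i j s t → σ i ≡ s → σ j ≡ t →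
                   edge (place i s) (place j t) ≡ adj (shape P) i j
      edge-place i j true true σi σj with i ≟ j
      ... | yes refl = trans (Graph.irrefl G _) (sym (Graph.irrefl (shape P) i))
      ... | no i≢j = trans (rowOf-colour _ _ (λ e → i≢j (label-injective (encode-injective labels e))))
                           (sym (part-true P i j i≢j σi σj))
      edge-place i j false false σi σj with i ≟ j
      ... | yes refl = trans (Graph.irrefl G _) (sym (Graph.irrefl (shape P) i))
      ... | no i≢j = trans (τ-colour _ _ (λ e → i≢j (slot-injective b₁ b₂ e)))
                           (sym (part-false P i j i≢j σi σj))
      edge-place i j true  false _  σj = edge-across i j σj
      edge-place i j false true  σi _  =
        trans (Graph.sym G _ _) (trans (edge-across j i σi) (Graph.sym (shape P) j i))

      place-injective : ∀ i j s t → place i s ≡ place j t → i ≡ j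
      place-injective i j true  true  e =
        label-injective (encode-injective labels (rowOf-injective (inj₁-injective e)))
      place-injective i j false false e =
        slot-injective b₁ b₂ (τ-injective (cong proj₂ (inj₂-injective e)))
      place-injective i j true  false ()
      place-injective i j false true  ()

      copy : InducedCopy (shape P) G
      copy = (λ u → encode vertices (place u (σ u)))
           , (λ {i} {j} e → place-injective i j (σ i) (σ j) (encode-injective vertices e))
           , (λ i j → edge-place i j (σ i) (σ j) refl refl)

  obstruction : IsBipartiteObstruction 𝓕 H
  obstruction G completion = order found , shape found , inFamily found , copy rowS posT
    where
    open Embedding G completion
    rowS : Homogeneous colourS m
    rowS = ramsey-Fin m colourS (λ s s′ → Graph.sym G _ _)
    posT : Homogeneous (colourT (tabulate (Homogeneous.pick rowS))) K
    posT = ramsey-Fin K (colourT (tabulate (Homogeneous.pick rowS))) (λ i i′ → Graph.sym G _ _)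
    found : SidedMember 𝓕 (Homogeneous.colour rowS) (Homogeneous.colour posT)
    found = P rowS posT

lemma2p2 : (𝓕 : Family) →
    Σ ℕ (λ n → Σ (Graph n) λ B → 𝓕 n B × IsBipartite B) →
    Σ ℕ (λ n → Σ (Graph n) λ C → 𝓕 n C × IsCoBipartite C) →
    Σ ℕ (λ n → Σ (Graph n) λ S → 𝓕 n S × IsSplit S) →
    HasBipartiteObstruction 𝓕
lemma2p2 𝓕 bip cobip split = H , obstruction
  where
  member : ∀ a b → SidedMember 𝓕 a b
  member = sidedMembers bip cobip split
  open Construction member (maxOver (λ a b → order (member a b)))
                           (≤-maxOver (λ a b → order (member a b)))
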